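{- Let $N_1$ and $N_2$ be $\operatorname{FS^{op}}$-modules over $\mathbb{Q}$ such that $N_1$ is finitely generated in degrees $\leq m_1$ and $N_2$ is finitely generated in degrees $\leq m_2$. Then the pointwise tensor product $N_1\otimes N_2$ (the $\operatorname{FS^{op}}$-module $E\mapsto N_1(E)\otimes_{\mathbb{Q}} N_2(E)$) is finitely generated in degrees $\leq m_1m_2$.
   Context: $\operatorname{FS}$ denotes the category whose objects are nonempty finite sets and whose morphisms are surjective maps. An $\operatorname{FS^{op}}$-module (over $\mathbb{Q}$) is a contravariant functor from $\operatorname{FS}$ to rational vector spaces. For a finite set $F$, the principal projective $P_F$ sends a finite set $E$ to the $\mathbb{Q}$-vector space with basis $\operatorname{Hom}_{\operatorname{FS}}(E,F)$, with morphisms acting on basis elements by composition. An $\operatorname{FS^{op}}$-module $N$ is finitely generated in degrees $\leq m$ if it is a quotient of a finite direct sum $\bigoplus_j P_{F_j}$ of principal projectives with $|F_j|\leq m$ for all $j$. -}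

module Defs where

open import Level using (Level; _⊔_) renaming (suc to lsuc)
open import Data.Nat using (ℕ; suc; _≤_)
open import Data.Fin using (Fin)
open import Data.Rational using (ℚ; 0ℚ) renaming (_+_ to _+ℚ_; _*_ to _*ℚ_)
open import Data.Rational.Properties using (+-*-ring)
open import Data.List using (List; []; _∷_; _++_; map; foldr)
open import Data.Product using (Σ; ∃; _×_; _,_)
open import Relation.Binary.PropositionalEquality using (_≡_)
open import Algebra.Module.Bundles using (LeftModule)

-- A nonempty finite set is represented (up to isomorphism) by
-- Fin (suc n), which has cardinality suc n.  Morphisms of FS are
-- surjections Fin (suc a) → Fin (suc b).  Functions are compared
-- pointwise (no function extensionality).

IsSurj : ∀ {a b} → (Fin a → Fin b) → Set
IsSurj f = ∀ y → ∃ λ x → f x ≡ y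

Vect : (c ℓ : Level) → Set (lsuc (c ⊔ ℓ))
Vect c ℓ = LeftModule +-*-ring c ℓ

record FSopModule (c ℓ : Level) : Set (lsuc (c ⊔ ℓ)) where
  field
    V : ℕ → Vect c ℓ             -- V n = N(Fin (suc n))
  open module V' (n : ℕ) = LeftModule (V n) public
  field
    act : ∀ {a b} (f : Fin (suc a) → Fin (suc b)) → IsSurj f →
          Carrierᴹ b → Carrierᴹ a
    act-cong : ∀ {a b} (f g : Fin (suc a) → Fin (suc b)) (p : IsSurj f) (q : IsSurj g) →
               (∀ i → f i ≡ g i) → ∀ {x y} → _≈ᴹ_ b x y → _≈ᴹ_ a (act f p x) (act g q y)
    act-+ : ∀ {a b} (f : Fin (suc a) → Fin (suc b)) (p : IsSurj f) (x y : Carrierᴹ b) →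
            _≈ᴹ_ a (act f p (_+ᴹ_ b x y)) (_+ᴹ_ a (act f p x) (act f p y))
    act-* : ∀ {a b} (f : Fin (suc a) → Fin (suc b)) (p : IsSurj f) (c : ℚ) (x : Carrierᴹ b) →
            _≈ᴹ_ a (act f p (_*ₗ_ b c x)) (_*ₗ_ a c (act f p x))
    act-id : ∀ {a} (p : IsSurj {suc a} (λ i → i)) (x : Carrierᴹ a) →
             _≈ᴹ_ a (act (λ i → i) p x) x
    act-∘ : ∀ {a b d} (f : Fin (suc a) → Fin (suc b)) (g : Fin (suc b) → Fin (suc d))
            (p : IsSurj f) (q : IsSurj g) (r : IsSurj (λ i → g (f i))) (x : Carrierᴹ d) →
            _≈ᴹ_ a (act (λ i → g (f i)) r x) (act f p (act g q x))

-- The data of an FS^op-module (operations only), enough to speak of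
-- generation.

record FSopData (c ℓ : Level) : Set (lsuc (c ⊔ ℓ)) where
  field
    Obj : ℕ → Set c
    _≈_ : ∀ {n} → Obj n → Obj n → Set ℓ
    _+_ : ∀ {n} → Obj n → Obj n → Obj n
    0# : ∀ {n} → Obj n
    _·_ : ∀ {n} → ℚ → Obj n → Obj n
    act : ∀ {a b} (f : Fin (suc a) → Fin (suc b)) → IsSurj f → Obj b → Obj a

forget : ∀ {c ℓ} → FSopModule c ℓ → FSopData c ℓ
forget N = record
  { Obj = Carrierᴹ ; _≈_ = λ {n} → _≈ᴹ_ n ; _+_ = λ {n} → _+ᴹ_ n ; 0# = λ {n} → 0ᴹ n
  ; _·_ = λ {n} → _*ₗ_ n ; act = act }
  where open FSopModule N

-- A surjection ⊕_{j<r} P_{F_j} ↠ N corresponds (Yoneda) to elements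
-- x_j ∈ N(F_j), and surjectivity at E says every element of N(E) is a
-- finite ℚ-linear combination of elements N(f)(x_j), f : E ↠ F_j
-- (the images of the basis elements f of P_{F_j}(E)).

module _ {c ℓ} (D : FSopData c ℓ) where
  open FSopData D

  -- a basis element of (⊕_j P_{F_j})(E) with a coefficient,
  -- where F_j = Fin (suc (deg j))
  Term : (r : ℕ) (deg : Fin r → ℕ) (e : ℕ) → Set
  Term r deg e = Σ (Fin r) λ j → ℚ × Σ (Fin (suc e) → Fin (suc (deg j))) IsSurj

  evalTerms : ∀ {r} {deg : Fin r → ℕ} (gen : (j : Fin r) → Obj (deg j)) {e : ℕ} →
              List (Term r deg e) → Obj e
  evalTerms gen = foldr (λ { (j , q , f , p) acc → (q · act f p (gen j)) + acc }) 0#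

  FinGenInDeg≤ : ℕ → Set (c ⊔ ℓ)
  FinGenInDeg≤ m =
    Σ ℕ λ r →
    Σ (Fin r → ℕ) λ deg →                       -- F_j = Fin (suc (deg j))
    ((j : Fin r) → suc (deg j) ≤ m) ×            -- |F_j| ≤ m
    Σ ((j : Fin r) → Obj (deg j)) λ gen →        -- images of id_{F_j}
    ((e : ℕ) (y : Obj e) → ∃ λ (ts : List (Term r deg e)) → y ≈ evalTerms gen ts)

-- Tensor product of ℚ-vector spaces, as formal sums Σ qᵢ (aᵢ ⊗ bᵢ)
-- modulo the equivalence relation generated by bilinearity.

module _ {c₁ ℓ₁ c₂ ℓ₂} (A : Vect c₁ ℓ₁) (B : Vect c₂ ℓ₂) where
  private
    module A = LeftModule A
    module B = LeftModule B

  TensorTm : Set (c₁ ⊔ c₂)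
  TensorTm = List (ℚ × A.Carrierᴹ × B.Carrierᴹ)

  data _∼⊗_ : TensorTm → TensorTm → Set (c₁ ⊔ c₂ ⊔ ℓ₁ ⊔ ℓ₂) where
    ∼refl  : ∀ {s} → s ∼⊗ s
    ∼sym   : ∀ {s t} → s ∼⊗ t → t ∼⊗ s
    ∼trans : ∀ {s t u} → s ∼⊗ t → t ∼⊗ u → s ∼⊗ u
    ∼++    : ∀ {s s' t t'} → s ∼⊗ s' → t ∼⊗ t' → (s ++ t) ∼⊗ (s' ++ t')
    ∼comm  : ∀ s t → (s ++ t) ∼⊗ (t ++ s)
    ∼zero  : ∀ a b → ((0ℚ , a , b) ∷ []) ∼⊗ []
    ∼coef+ : ∀ p q a b → ((p , a , b) ∷ (q , a , b) ∷ []) ∼⊗ ((p +ℚ q , a , b) ∷ [])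
    ∼left+ : ∀ q a a' b →
             ((q , a A.+ᴹ a' , b) ∷ []) ∼⊗ ((q , a , b) ∷ (q , a' , b) ∷ [])
    ∼right+ : ∀ q a b b' →
             ((q , a , b B.+ᴹ b') ∷ []) ∼⊗ ((q , a , b) ∷ (q , a , b') ∷ [])
    ∼left* : ∀ q p a b → ((q , p A.*ₗ a , b) ∷ []) ∼⊗ ((q *ℚ p , a , b) ∷ [])
    ∼right* : ∀ q p a b → ((q , a , p B.*ₗ b) ∷ []) ∼⊗ ((q *ℚ p , a , b) ∷ [])
    ∼leftCong : ∀ q {a a'} b → a A.≈ᴹ a' → ((q , a , b) ∷ []) ∼⊗ ((q , a' , b) ∷ [])
    ∼rightCong : ∀ q a {b b'} → b B.≈ᴹ b' → ((q , a , b) ∷ []) ∼⊗ ((q , a , b') ∷ [])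

  scaleTm : ℚ → TensorTm → TensorTm
  scaleTm p = map (λ { (q , a , b) → (p *ℚ q , a , b) })

_⊗FS_ : ∀ {c₁ ℓ₁ c₂ ℓ₂} → FSopModule c₁ ℓ₁ → FSopModule c₂ ℓ₂ →
        FSopData (c₁ ⊔ c₂) (c₁ ⊔ c₂ ⊔ ℓ₁ ⊔ ℓ₂)
N₁ ⊗FS N₂ = record
  { Obj = λ n → TensorTm (N₁.V n) (N₂.V n)
  ; _≈_ = λ {n} → _∼⊗_ (N₁.V n) (N₂.V n)
  ; _+_ = _++_
  ; 0# = []
  ; _·_ = λ {n} → scaleTm (N₁.V n) (N₂.V n)
  ; act = λ f p → map (λ { (q , a , b) → (q , N₁.act f p a , N₂.act f p b) })
  }
  where
    module N₁ = FSopModule N₁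
    module N₂ = FSopModule N₂

-- A pure tensor N₁(f)(x) ⊗ N₂(g)(y) with f : E ↠ F and g : E ↠ G factors
-- through the image K of ⟨f , g⟩ : E → F × G: writing ⟨f , g⟩ = ι ∘ h with
-- h : E ↠ K and ι : K ↪ F × G, it is the image under h of N₁(π₁ ∘ ι)(x) ⊗ N₂(π₂ ∘ ι)(y),
-- and |K| ≤ |F| |G|.  Expanding an arbitrary element of N₁(E) ⊗ N₂(E)
-- bilinearly in the generators of N₁ and N₂, the elements
-- N₁(s₁)(x_j) ⊗ N₂(s₂)(y_k) for all surjections s₁ : K ↠ F_j, s₂ : K ↠ G_k
-- with |K| ≤ m₁ m₂ therefore generate N₁ ⊗ N₂.
module Submission where

open import Defs
open import Level using (Level; _⊔_)
open import Function using (_∘_)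
open import Data.Nat using (ℕ; zero; suc; _*_; _≤_)
open import Data.Nat.Properties using (≤-trans; *-mono-≤)
open import Data.Fin using (Fin; toℕ; fromℕ<; combine) renaming (zero to fzero; suc to fsuc)
open import Data.Fin.Properties using (any?; all?; injective⇒≤; combine-injective; toℕ<n; toℕ-fromℕ<)
  renaming (_≟_ to _≟ᶠ_)
open import Data.Vec.Functional using (head; tail) renaming (_∷_ to _∷ᶠ_)
open import Data.List using (List; []; _∷_; _++_; map; concatMap; length; lookup; allFin; cartesianProduct)
open import Data.List.Properties using (++-assoc; ++-identityʳ)
open import Data.List.Membership.Propositional using (_∈_; lose)
open import Data.List.Membership.Propositional.Properties
  using (∈-map⁺; ∈-concatMap⁺; ∈-allFin; ∈-cartesianProduct⁺)
open import Data.List.Relation.Unary.Any using (here; there; index)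
open import Data.List.Relation.Unary.Any.Properties using (lookup-index)
open import Data.Product using (Σ; ∃; _×_; _,_; proj₁; proj₂)
open import Data.Product.Properties using (≡-dec; ×-≡,≡→≡)
open import Data.Rational using (0ℚ; 1ℚ) renaming (_*_ to _*ℚ_)
open import Data.Rational.Properties using (*-zeroʳ; *-identityʳ)
open import Relation.Nullary using (Dec; yes; no; contradiction)
open import Relation.Unary using (Decidable)
open import Relation.Binary using (DecidableEquality)
open import Relation.Binary.PropositionalEquality using (_≡_; _≢_; _≗_; refl; sym; trans; cong; subst)
open import Algebra.Module.Bundles using (LeftModule)

private
  variable
    a p : Level
    A : Set a

Σ-list : {B : A → Set p} → List A → ((x : A) → List (B x)) → List (Σ A B)
Σ-list xs ys = concatMap (λ x → map (x ,_) (ys x)) xs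

∈-Σ-list : ∀ {B : A → Set p} {xs : List A} {ys : (x : A) → List (B x)} {x y} →
           x ∈ xs → y ∈ ys x → (x , y) ∈ Σ-list xs ys
∈-Σ-list {ys = ys} x∈ y∈ = ∈-concatMap⁺ (λ x → map (x ,_) (ys x)) (lose x∈ (∈-map⁺ _ y∈))

filterΣ : {P : A → Set p} → Decidable P → List A → List (Σ A P)
filterΣ P? [] = []
filterΣ P? (x ∷ xs) with P? x
... | yes px = (x , px) ∷ filterΣ P? xs
... | no _ = filterΣ P? xs

∈-filterΣ : ∀ {P : A → Set p} (P? : Decidable P) {x xs} → x ∈ xs → P x →
            ∃ λ px → (x , px) ∈ filterΣ P? xs
∈-filterΣ P? {xs = y ∷ ys} x∈ px with P? y | x∈
... | yes py | here refl = py , here refl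
... | no ¬py | here refl = contradiction px ¬py
... | yes _  | there x∈ys = let (px′ , mem) = ∈-filterΣ P? x∈ys px in px′ , there mem
... | no _   | there x∈ys = ∈-filterΣ P? x∈ys px

allFunctions : ∀ n m → List (Fin n → Fin m)
allFunctions zero    m = (λ ()) ∷ []
allFunctions (suc n) m = concatMap (λ y → map (y ∷ᶠ_) (allFunctions n m)) (allFin m)

∈-allFunctions : ∀ {n m} (f : Fin n → Fin m) → ∃ λ g → g ∈ allFunctions n m × g ≗ f
∈-allFunctions {zero} f = (λ ()) , here refl , λ ()
∈-allFunctions {suc n} {m} f with ∈-allFunctions (tail f)
... | g , g∈ , g≗ = head f ∷ᶠ g , head∷g∈ , λ { fzero → refl ; (fsuc i) → g≗ i }
  where
    head∷g∈ : (head f ∷ᶠ g) ∈ allFunctions (suc n) m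
    head∷g∈ = ∈-concatMap⁺ (λ y → map (y ∷ᶠ_) (allFunctions n m))
                (lose (∈-allFin (head f)) (∈-map⁺ (head f ∷ᶠ_) g∈))


IsSurj-resp-≗ : ∀ {m n} {f g : Fin m → Fin n} → f ≗ g → IsSurj f → IsSurj g
IsSurj-resp-≗ f≗g f-surj y = let (x , fx≡y) = f-surj y in x , trans (sym (f≗g x)) fx≡y

IsSurj-∘⁻ : ∀ {m k n} {f : Fin m → Fin n} (g : Fin k → Fin n) (h : Fin m → Fin k) →
            (∀ x → g (h x) ≡ f x) → IsSurj f → IsSurj g
IsSurj-∘⁻ g h gh≗f f-surj y = let (x , fx≡y) = f-surj y in h x , trans (gh≗f x) fx≡y

isSurj? : ∀ {m n} (f : Fin m → Fin n) → Dec (IsSurj f)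
isSurj? f = all? λ y → any? λ x → f x ≟ᶠ y

Surj : ℕ → ℕ → Set
Surj a b = Σ (Fin (suc a) → Fin (suc b)) IsSurj

surjections : ∀ a b → List (Surj a b)
surjections a b = filterΣ isSurj? (allFunctions (suc a) (suc b))

∈-surjections : ∀ {a b} (f : Fin (suc a) → Fin (suc b)) → IsSurj f →
                ∃ λ s → s ∈ surjections a b × proj₁ s ≗ f
∈-surjections f f-surj with ∈-allFunctions f
... | g , g∈ , g≗f = let (g-surj , mem) = ∈-filterΣ isSurj? g∈ (IsSurj-resp-≗ (sym ∘ g≗f) f-surj)
                     in (g , g-surj) , mem , g≗f

record Factorisation {A : Set a} {e : ℕ} (g : Fin (suc e) → A) (n : ℕ) : Set a where
  field
    surjection : Fin (suc e) → Fin (suc n)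
    surjective : IsSurj surjection
    injection  : Fin (suc n) → A
    injective  : ∀ {i j} → injection i ≡ injection j → i ≡ j
    factorises : ∀ x → injection (surjection x) ≡ g x

module _ {A : Set a} {e : ℕ} {g : Fin (suc (suc e)) → A} {n : ℕ} (F : Factorisation (tail g) n) where
  open Factorisation F

  Factorisation-∷-old : ∀ i → injection i ≡ head g → Factorisation g n
  Factorisation-∷-old i ιi≡ = record
    { surjection = i ∷ᶠ surjection
    ; surjective = λ y → let (x , hx≡y) = surjective y in fsuc x , hx≡y
    ; injection  = injection
    ; injective  = injective
    ; factorises = λ { fzero → ιi≡ ; (fsuc x) → factorises x }
    }

  Factorisation-∷-new : (∀ i → injection i ≢ head g) → Factorisation g (suc n)
  Factorisation-∷-new ι≢ = record
    { surjection = fzero ∷ᶠ (fsuc ∘ surjection)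
    ; surjective = λ { fzero → fzero , refl
                     ; (fsuc y) → let (x , hx≡y) = surjective y in fsuc x , cong fsuc hx≡y }
    ; injection  = head g ∷ᶠ injection
    ; injective  = injective′
    ; factorises = λ { fzero → refl ; (fsuc x) → factorises x }
    }
    where
      injective′ : ∀ {i j} → (head g ∷ᶠ injection) i ≡ (head g ∷ᶠ injection) j → i ≡ j
      injective′ {fzero}  {fzero}  _  = refl
      injective′ {fzero}  {fsuc j} eq = contradiction (sym eq) (ι≢ j)
      injective′ {fsuc i} {fzero}  eq = contradiction eq (ι≢ i)
      injective′ {fsuc i} {fsuc j} eq = cong fsuc (injective eq)

image : {A : Set a} → DecidableEquality A → ∀ {e} (g : Fin (suc e) → A) → ∃ (Factorisation g)
image _≟_ {zero} g = zero , record
  { surjection = λ _ → fzero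
  ; surjective = λ { fzero → fzero , refl }
  ; injection  = λ _ → g fzero
  ; injective  = λ { {fzero} {fzero} _ → refl }
  ; factorises = λ { fzero → refl }
  }
image _≟_ {suc e} g with image _≟_ (tail g)
... | n , F with any? (λ i → Factorisation.injection F i ≟ head g)
...   | yes (i , ιi≡) = n , Factorisation-∷-old F i ιi≡
...   | no ∄i = suc n , Factorisation-∷-new F (λ i ιi≡ → ∄i (i , ιi≡))

Factorisation⇒≤ : ∀ {a b e n} {g : Fin (suc e) → Fin a × Fin b} → Factorisation g n → suc n ≤ a * b
Factorisation⇒≤ F =
  injective⇒≤ {f = λ i → combine (proj₁ (injection i)) (proj₂ (injection i))}
    (λ eq → injective (×-≡,≡→≡ (combine-injective _ _ _ _ eq)))
  where open Factorisation F

module _ {c ℓ} (N : FSopModule c ℓ) where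
  open FSopModule N

  act-factorises : ∀ {a k b} (f : Fin (suc a) → Fin (suc b)) (f-surj : IsSurj f)
                   (h : Fin (suc a) → Fin (suc k)) (h-surj : IsSurj h)
                   (s : Fin (suc k) → Fin (suc b)) (s-surj : IsSurj s) →
                   (∀ x → s (h x) ≡ f x) →
                   ∀ y → _≈ᴹ_ a (act f f-surj y) (act h h-surj (act s s-surj y))
  act-factorises {a} {b = b} f f-surj h h-surj s s-surj sh≗f y =
    ≈ᴹ-trans a (act-cong f (s ∘ h) f-surj sh-surj (sym ∘ sh≗f) (≈ᴹ-refl b))
               (act-∘ h s h-surj s-surj sh-surj y)
    where
      sh-surj : IsSurj (s ∘ h)
      sh-surj = IsSurj-resp-≗ (sym ∘ sh≗f) f-surj

module _ {c₁ ℓ₁ c₂ ℓ₂} {A : Vect c₁ ℓ₁} {B : Vect c₂ ℓ₂} where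
  private
    module A = LeftModule A
    module B = LeftModule B

  ≡⇒∼⊗ : ∀ {s t} → s ≡ t → _∼⊗_ A B s t
  ≡⇒∼⊗ refl = ∼refl

  ∼⊗-coef-≡ : ∀ {p q} a b → p ≡ q → _∼⊗_ A B ((p , a , b) ∷ []) ((q , a , b) ∷ [])
  ∼⊗-coef-≡ a b refl = ∼refl

  ∼⊗-zeroˡ : ∀ q b → _∼⊗_ A B ((q , A.0ᴹ , b) ∷ []) []
  ∼⊗-zeroˡ q b =
    ∼trans (∼leftCong q b (A.≈ᴹ-sym (A.*ₗ-zeroˡ A.0ᴹ)))
    (∼trans (∼left* q 0ℚ A.0ᴹ b)
    (∼trans (∼⊗-coef-≡ A.0ᴹ b (*-zeroʳ q))
            (∼zero A.0ᴹ b)))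

  ∼⊗-zeroʳ : ∀ q a → _∼⊗_ A B ((q , a , B.0ᴹ) ∷ []) []
  ∼⊗-zeroʳ q a =
    ∼trans (∼rightCong q a (B.≈ᴹ-sym (B.*ₗ-zeroˡ B.0ᴹ)))
    (∼trans (∼right* q 0ℚ a B.0ᴹ)
    (∼trans (∼⊗-coef-≡ a B.0ᴹ (*-zeroʳ q))
            (∼zero a B.0ᴹ)))

module Span {c₁ ℓ₁ c₂ ℓ₂} (N₁ : FSopModule c₁ ℓ₁) (N₂ : FSopModule c₂ ℓ₂) where
  private
    module N₁ = FSopModule N₁
    module N₂ = FSopModule N₂
  open FSopData (N₁ ⊗FS N₂) using (Obj; act; _·_; _≈_)

  InSpan : ∀ {r} {deg : Fin r → ℕ} → ((j : Fin r) → Obj (deg j)) → (e : ℕ) → Obj e →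
           Set (c₁ ⊔ c₂ ⊔ ℓ₁ ⊔ ℓ₂)
  InSpan {r} {deg} gen e y = ∃ λ (ts : List (Term (N₁ ⊗FS N₂) r deg e)) → y ≈ evalTerms (N₁ ⊗FS N₂) gen ts

  module _ {r} {deg : Fin r → ℕ} (gen : (j : Fin r) → Obj (deg j)) {e : ℕ} where
    private
      eval = evalTerms (N₁ ⊗FS N₂) gen

    evalTerms-++ : ∀ (ts ts′ : List (Term (N₁ ⊗FS N₂) r deg e)) → eval (ts ++ ts′) ≡ eval ts ++ eval ts′
    evalTerms-++ [] ts′ = refl
    evalTerms-++ ((j , q , f , f-surj) ∷ ts) ts′ =
      trans (cong (q · act f f-surj (gen j) ++_) (evalTerms-++ ts ts′))
            (sym (++-assoc (q · act f f-surj (gen j)) (eval ts) (eval ts′)))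

    InSpan-[] : InSpan gen e []
    InSpan-[] = [] , ∼refl

    InSpan-++ : ∀ {s t} → InSpan gen e s → InSpan gen e t → InSpan gen e (s ++ t)
    InSpan-++ (ts , s∼) (ts′ , t∼) = ts ++ ts′ , ∼trans (∼++ s∼ t∼) (≡⇒∼⊗ (sym (evalTerms-++ ts ts′)))

    InSpan-resp : ∀ {s t} → s ≈ t → InSpan gen e t → InSpan gen e s
    InSpan-resp s∼t (ts , t∼) = ts , ∼trans s∼t t∼

    InSpan-generator : ∀ j q (h : Fin (suc e) → Fin (suc (deg j))) (h-surj : IsSurj h) →
                       InSpan gen e (q · act h h-surj (gen j))
    InSpan-generator j q h h-surj = (j , q , h , h-surj) ∷ [] , ≡⇒∼⊗ (sym (++-identityʳ _))

  module _ {I : Set} (xs : List I) {deg : I → ℕ} (gen : (x : I) → Obj (deg x)) where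

    InSpan-∈ : ∀ {x e} → x ∈ xs → ∀ q (h : Fin (suc e) → Fin (suc (deg x))) (h-surj : IsSurj h) →
               InSpan (gen ∘ lookup xs) e (q · act h h-surj (gen x))
    InSpan-∈ x∈ with index x∈ | lookup-index x∈
    ... | i | refl = InSpan-generator (gen ∘ lookup xs) i

  module Expansion
    {r₁} {d₁ : Fin r₁ → ℕ} (gen₁ : (j : Fin r₁) → N₁.Carrierᴹ (d₁ j))
    {r₂} {d₂ : Fin r₂ → ℕ} (gen₂ : (j : Fin r₂) → N₂.Carrierᴹ (d₂ j))
    {r} {deg : Fin r → ℕ} (gen : (j : Fin r) → Obj (deg j))
    (pure : ∀ {e} q j₁ (f₁ : Fin (suc e) → Fin (suc (d₁ j₁))) (f₁-surj : IsSurj f₁)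
              j₂ (f₂ : Fin (suc e) → Fin (suc (d₂ j₂))) (f₂-surj : IsSurj f₂) →
            InSpan gen e ((q , N₁.act f₁ f₁-surj (gen₁ j₁) , N₂.act f₂ f₂-surj (gen₂ j₂)) ∷ []))
    where

    private
      eval₁ = evalTerms (forget N₁) gen₁
      eval₂ = evalTerms (forget N₂) gen₂

    InSpan-⊗ʳ : ∀ {e} q j₁ (f₁ : Fin (suc e) → Fin (suc (d₁ j₁))) (f₁-surj : IsSurj f₁) ts₂ →
                InSpan gen e ((q , N₁.act f₁ f₁-surj (gen₁ j₁) , eval₂ ts₂) ∷ [])
    InSpan-⊗ʳ q j₁ f₁ f₁-surj [] = InSpan-resp gen (∼⊗-zeroʳ q _) (InSpan-[] gen)
    InSpan-⊗ʳ q j₁ f₁ f₁-surj ((j₂ , c , f₂ , f₂-surj) ∷ ts₂) =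
      InSpan-resp gen (∼trans (∼right+ q x _ _) (∼++ (∼right* q c x _) ∼refl))
        (InSpan-++ gen (pure (q *ℚ c) j₁ f₁ f₁-surj j₂ f₂ f₂-surj) (InSpan-⊗ʳ q j₁ f₁ f₁-surj ts₂))
      where x = N₁.act f₁ f₁-surj (gen₁ j₁)

    InSpan-⊗ : ∀ {e} q ts₁ ts₂ → InSpan gen e ((q , eval₁ ts₁ , eval₂ ts₂) ∷ [])
    InSpan-⊗ q [] ts₂ = InSpan-resp gen (∼⊗-zeroˡ q _) (InSpan-[] gen)
    InSpan-⊗ q ((j₁ , c , f₁ , f₁-surj) ∷ ts₁) ts₂ =
      InSpan-resp gen (∼trans (∼left+ q _ _ y) (∼++ (∼left* q c _ y) ∼refl))
        (InSpan-++ gen (InSpan-⊗ʳ (q *ℚ c) j₁ f₁ f₁-surj ts₂) (InSpan-⊗ q ts₁ ts₂))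
      where y = eval₂ ts₂

    InSpan-all : (∀ e x → ∃ λ ts → N₁._≈ᴹ_ e x (eval₁ ts)) →
                 (∀ e y → ∃ λ ts → N₂._≈ᴹ_ e y (eval₂ ts)) →
                 ∀ e z → InSpan gen e z
    InSpan-all spans₁ spans₂ e [] = InSpan-[] gen
    InSpan-all spans₁ spans₂ e ((q , x , y) ∷ z)
      with spans₁ e x | spans₂ e y
    ... | ts₁ , x≈ | ts₂ , y≈ =
      InSpan-++ gen (InSpan-resp gen (∼trans (∼leftCong q y x≈) (∼rightCong q _ y≈)) (InSpan-⊗ q ts₁ ts₂))
                    (InSpan-all spans₁ spans₂ e z)

module ProductGenerators {c₁ ℓ₁ c₂ ℓ₂} (N₁ : FSopModule c₁ ℓ₁) (N₂ : FSopModule c₂ ℓ₂)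
  {r₁} {d₁ : Fin r₁ → ℕ} (gen₁ : (j : Fin r₁) → FSopModule.Carrierᴹ N₁ (d₁ j))
  {r₂} {d₂ : Fin r₂ → ℕ} (gen₂ : (j : Fin r₂) → FSopModule.Carrierᴹ N₂ (d₂ j))
  (M : ℕ) where

  private
    module N₁ = FSopModule N₁
    module N₂ = FSopModule N₂
  open FSopData (N₁ ⊗FS N₂) using (Obj)
  open Span N₁ N₂
  open Factorisation using (surjection; surjective; injection; factorises)

  -- k : Fin M stands for the quotient Fin (suc (toℕ k)), of size at most M.
  Index : Set
  Index = Σ (Fin r₁) λ j₁ → Σ (Fin r₂) λ j₂ → Σ (Fin M) λ k → Surj (toℕ k) (d₁ j₁) × Surj (toℕ k) (d₂ j₂)

  indices : List Index
  indices = Σ-list (allFin r₁) λ j₁ → Σ-list (allFin r₂) λ j₂ → Σ-list (allFin M) λ k →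
            cartesianProduct (surjections (toℕ k) (d₁ j₁)) (surjections (toℕ k) (d₂ j₂))

  degree : Index → ℕ
  degree (_ , _ , k , _) = toℕ k

  degree< : (x : Index) → suc (degree x) ≤ M
  degree< (_ , _ , k , _) = toℕ<n k

  generator : (x : Index) → Obj (degree x)
  generator (j₁ , j₂ , k , (s₁ , s₁-surj) , (s₂ , s₂-surj)) =
    (1ℚ , N₁.act s₁ s₁-surj (gen₁ j₁) , N₂.act s₂ s₂-surj (gen₂ j₂)) ∷ []

  generators : (i : Fin (length indices)) → Obj (degree (lookup indices i))
  generators = generator ∘ lookup indices

  InSpan-factorisation :
    ∀ {e} q j₁ (f₁ : Fin (suc e) → Fin (suc (d₁ j₁))) (f₁-surj : IsSurj f₁)
            j₂ (f₂ : Fin (suc e) → Fin (suc (d₂ j₂))) (f₂-surj : IsSurj f₂) (k : Fin M) →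
    Factorisation (λ x → f₁ x , f₂ x) (toℕ k) →
    InSpan generators e ((q , N₁.act f₁ f₁-surj (gen₁ j₁) , N₂.act f₂ f₂-surj (gen₂ j₂)) ∷ [])
  InSpan-factorisation q j₁ f₁ f₁-surj j₂ f₂ f₂-surj k F
    with ∈-surjections (proj₁ ∘ injection F) (IsSurj-∘⁻ _ (surjection F) (cong proj₁ ∘ factorises F) f₁-surj)
       | ∈-surjections (proj₂ ∘ injection F) (IsSurj-∘⁻ _ (surjection F) (cong proj₂ ∘ factorises F) f₂-surj)
  ... | s₁ , s₁∈ , s₁≗ | s₂ , s₂∈ , s₂≗ =
    InSpan-resp generators pure≈generator
      (InSpan-∈ indices generator x∈ q (surjection F) (surjective F))
    where
      x∈ : (j₁ , j₂ , k , s₁ , s₂) ∈ indices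
      x∈ = ∈-Σ-list (∈-allFin j₁) (∈-Σ-list (∈-allFin j₂) (∈-Σ-list (∈-allFin k)
             (∈-cartesianProduct⁺ s₁∈ s₂∈)))
      x₁≈ = act-factorises N₁ f₁ f₁-surj (surjection F) (surjective F) (proj₁ s₁) (proj₂ s₁)
              (λ x → trans (s₁≗ (surjection F x)) (cong proj₁ (factorises F x))) (gen₁ j₁)
      x₂≈ = act-factorises N₂ f₂ f₂-surj (surjection F) (surjective F) (proj₁ s₂) (proj₂ s₂)
              (λ x → trans (s₂≗ (surjection F x)) (cong proj₂ (factorises F x))) (gen₂ j₂)
      pure≈generator = ∼trans (∼leftCong q _ x₁≈) (∼trans (∼rightCong q _ x₂≈)
        (∼⊗-coef-≡ _ _ (sym (*-identityʳ q))))

  module _ (small : ∀ j₁ j₂ → suc (d₁ j₁) * suc (d₂ j₂) ≤ M) where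

    InSpan-pure :
      ∀ {e} q j₁ (f₁ : Fin (suc e) → Fin (suc (d₁ j₁))) (f₁-surj : IsSurj f₁)
              j₂ (f₂ : Fin (suc e) → Fin (suc (d₂ j₂))) (f₂-surj : IsSurj f₂) →
      InSpan generators e ((q , N₁.act f₁ f₁-surj (gen₁ j₁) , N₂.act f₂ f₂-surj (gen₂ j₂)) ∷ [])
    InSpan-pure q j₁ f₁ f₁-surj j₂ f₂ f₂-surj with image (≡-dec _≟ᶠ_ _≟ᶠ_) (λ x → f₁ x , f₂ x)
    ... | n , F = InSpan-factorisation q j₁ f₁ f₁-surj j₂ f₂ f₂-surj k
                    (subst (Factorisation _) (sym (toℕ-fromℕ< n<M)) F)
      where
        n<M = ≤-trans (Factorisation⇒≤ F) (small j₁ j₂)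
        k = fromℕ< n<M

    finGen : (∀ e x → ∃ λ ts → N₁._≈ᴹ_ e x (evalTerms (forget N₁) gen₁ ts)) →
             (∀ e y → ∃ λ ts → N₂._≈ᴹ_ e y (evalTerms (forget N₂) gen₂ ts)) →
             FinGenInDeg≤ (N₁ ⊗FS N₂) M
    finGen spans₁ spans₂ =
      length indices , degree ∘ lookup indices , degree< ∘ lookup indices , generators ,
      Expansion.InSpan-all gen₁ gen₂ generators InSpan-pure spans₁ spans₂

lemma2p1 : ∀ {c₁ ℓ₁ c₂ ℓ₂ : Level} (N₁ : FSopModule c₁ ℓ₁) (N₂ : FSopModule c₂ ℓ₂) (m₁ m₂ : ℕ) →
    FinGenInDeg≤ (forget N₁) m₁ → FinGenInDeg≤ (forget N₂) m₂ →
    FinGenInDeg≤ (N₁ ⊗FS N₂) (m₁ * m₂)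
lemma2p1 N₁ N₂ m₁ m₂ (_ , _ , d₁< , gen₁ , spans₁) (_ , _ , d₂< , gen₂ , spans₂) =
  ProductGenerators.finGen N₁ N₂ gen₁ gen₂ (m₁ * m₂) (λ j₁ j₂ → *-mono-≤ (d₁< j₁) (d₂< j₂)) spans₁ spans₂
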